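{- For every finite set $\mathcal{F}$ of graphs, let $\ell$ be the maximum number of connected components of a graph in $\mathcal{F}$, let $c$ be the maximum number of vertices of a connected component of a graph in $\mathcal{F}$, and let $\alpha_{\mathcal{F}}=|\mathcal{F}|\cdot\ell\cdot c^2$. Then for any graph $G$ there exists $\mathcal{F}'\in\mathsf{Conn}(\mathcal{F})$ such that $\mathsf{opt}(G,\mathcal{F}')\le\mathsf{opt}(G,\mathcal{F})+\alpha_{\mathcal{F}}$.
   Context: All graphs are finite and simple. For a graph $G$ and a finite set $\mathcal{F}$ of graphs, $\mathsf{opt}(G,\mathcal{F})$ is the minimum size of a set $S\subseteq V(G)$ such that $G-S$ contains no subgraph isomorphic to some $F\in\mathcal{F}$. For a finite set $\mathcal{F}=\{F_1,\dots,F_m\}$ of graphs, $\mathsf{Conn}(\mathcal{F})$ is the collection of all sets $\{C_1,\dots,C_m\}$ where, for each $i$, $C_i$ is a connected component of $F_i$. -}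

module Defs where

open import Data.Nat using (ℕ; zero; suc; _+_; _*_; _≤_)
open import Data.Fin using (Fin)
open import Data.Fin.Subset using (Subset; _∈_; _∉_; ∣_∣)
open import Data.Bool using (Bool; true; false)
open import Data.List using (List; length)
open import Data.List.Relation.Binary.Pointwise using (Pointwise)
import Data.List.Membership.Propositional as L
open import Data.Product using (Σ; ∃; _×_; _,_)
open import Data.Sum using (_⊎_)
open import Relation.Binary.PropositionalEquality using (_≡_)
open import Relation.Nullary using (¬_)
open import Function.Definitions using (Injective; Surjective)
open import Function.Bundles using (_⇔_)

record Graph : Set where
  field
    n      : ℕ
    adj    : Fin n → Fin n → Bool
    sym    : ∀ u v → adj u v ≡ adj v u
    irrefl : ∀ v → adj v v ≡ false
open Graph public

Adj : (G : Graph) → Fin (n G) → Fin (n G) → Set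
Adj G u v = adj G u v ≡ true

data Reachable (G : Graph) : Fin (n G) → Fin (n G) → Set where
  here : ∀ {v} → Reachable G v v
  step : ∀ {u v w} → Adj G u v → Reachable G v w → Reachable G u w

Connected : Graph → Set
Connected G = ∀ u v → Reachable G u v

-- G - S contains a subgraph isomorphic to F: an injective map of V(F)
-- into V(G) \ S sending edges to edges.
ContainsAvoiding : (G : Graph) → Subset (n G) → Graph → Set
ContainsAvoiding G S F =
  Σ (Fin (n F) → Fin (n G)) λ φ →
    Injective _≡_ _≡_ φ ×
    (∀ v → φ v ∉ S) ×
    (∀ u v → Adj F u v → Adj G (φ u) (φ v))

Hits : (G : Graph) → List Graph → Subset (n G) → Set
Hits G Fs S = ∀ F → F L.∈ Fs → ¬ ContainsAvoiding G S F

IsOpt : (G : Graph) → List Graph → ℕ → Set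
IsOpt G Fs k =
  (Σ (Subset (n G)) λ S → Hits G Fs S × ∣ S ∣ ≡ k) ×
  (∀ S → Hits G Fs S → k ≤ ∣ S ∣)

-- K is (isomorphic to) a connected component of H: K is nonempty and
-- connected, e is an isomorphism of K onto the induced subgraph H[e(V(K))],
-- and the image e(V(K)) is closed under adjacency in H.
IsComponent : Graph → Graph → Set
IsComponent K H =
  Σ (Fin (n K) → Fin (n H)) λ e →
    Injective _≡_ _≡_ e ×
    (∀ u v → adj H (e u) (e v) ≡ adj K u v) ×
    Connected K ×
    (1 ≤ n K) ×
    (∀ u w → Adj H (e u) w → ∃ λ v → e v ≡ w)

-- H has exactly k connected components: the reachability classes are in
-- bijection with Fin k.
NumComponents : Graph → ℕ → Set
NumComponents H k =
  Σ (Fin (n H) → Fin k) λ f →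
    Surjective _≡_ _≡_ f ×
    (∀ u v → (f u ≡ f v) ⇔ Reachable H u v)

-- Conn(Fs): lists choosing, for each F_i, one connected component C_i.
InConn : List Graph → List Graph → Set
InConn Fs' Fs = Pointwise IsComponent Fs' Fs

-- ℓ is the maximum number of components of a member of Fs (0 if Fs = []).
IsMaxNumComponents : List Graph → ℕ → Set
IsMaxNumComponents Fs ℓ =
  (∀ F → F L.∈ Fs → ∀ k → NumComponents F k → k ≤ ℓ) ×
  (ℓ ≡ 0 ⊎ Σ Graph λ F → F L.∈ Fs × NumComponents F ℓ)

IsMaxComponentSize : List Graph → ℕ → Set
IsMaxComponentSize Fs c =
  (∀ F → F L.∈ Fs → ∀ K → IsComponent K F → n K ≤ c) ×
  (c ≡ 0 ⊎ Σ Graph λ F → F L.∈ Fs × Σ Graph λ K → IsComponent K F × n K ≡ c)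

alpha : List Graph → ℕ → ℕ → ℕ
alpha Fs ℓ c = length Fs * ℓ * (c * c)

-- Let S be an optimal hitting set for Fs. Fix F ∈ Fs with components
-- K₁, …, K_r (r ≤ ℓ, each of at most c vertices). Greedily embed K₁ into
-- G − S, then K₂ into G − S minus the image of K₁, and so on. Not every
-- step can succeed, since the copies would be disjoint and glue to a copy
-- of F in G − S. So some Kᵢ is absent from G − (S ∪ X), where X is the
-- union of the earlier images, |X| ≤ r·c ≤ ℓ·c². Choosing such a Kᵢ for
-- every F gives F' ∈ Conn(Fs) hit by S ∪ ⋃ X, a set of size at most
-- opt(G, Fs) + |Fs|·ℓ·c².
module Submission where

open import Defs
open import Data.Bool using (true) renaming (_≟_ to _≟ᵇ_)
open import Data.Empty using (⊥-elim)
open import Data.Fin using (Fin; zero; suc; finToFun; funToFin)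
open import Data.Fin.Properties
  using (any?; all?; suc-injective; toℕ<n; finToFun-funToFin) renaming (_≟_ to _≟ᶠ_)
open import Data.Fin.Subset using (Subset; _∈_; _∉_; _⊆_; _⊃_; ∣_∣; _∪_; ⁅_⁆; ⊥; inside; outside)
open import Data.Fin.Subset.Induction using (⊃-wellFounded)
open import Data.Fin.Subset.Properties
  using (_∈?_; anySubset?; ∣⊥∣≡0; ∣⁅x⁆∣≡1; x∈⁅x⁆; x∈⁅y⁆⇒x≡y; p⊆p∪q; q⊆p∪q; x∈p∪q⁻; x∈p∪q⁺; ⊆-reflexive; ∪-assoc)
open import Data.List using (List; []; _∷_; length; filter; allFin; lookup)
open import Data.List.Membership.Propositional using () renaming (_∈_ to _∈ˡ_)
open import Data.List.Membership.Propositional.Properties using (∈-filter⁺; ∈-filter⁻; ∈-allFin; ∈-lookup)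
open import Data.List.Relation.Binary.Pointwise using ([]; _∷_)
open import Data.List.Relation.Unary.All as All using ()
open import Data.List.Relation.Unary.AllPairs using (_∷_)
open import Data.List.Relation.Unary.Any using (here; there; index)
open import Data.List.Relation.Unary.Any.Properties using (lookup-index)
open import Data.List.Relation.Unary.Unique.Propositional using (Unique)
open import Data.List.Relation.Unary.Unique.Propositional.Properties using (filter⁺; allFin⁺)
open import Data.Nat using (ℕ; zero; suc; _+_; _*_; _≤_; _<_; _<?_; z≤n; s≤s)
open import Data.Nat.Induction using (<-wellFounded)
open import Data.Nat.Properties
  using ( ≤-refl; ≤-reflexive; ≤-trans; <⇒≤; ≮⇒≥; n≤1+n; +-suc; +-mono-≤; +-monoʳ-≤; *-mono-≤; *-assoc; m≤m*n
        ; module ≤-Reasoning)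
open import Data.Product using (Σ; ∃; _×_; _,_; proj₁; proj₂)
open import Data.Sum using (_⊎_; inj₁; inj₂; map₂)
open import Data.Vec using ([]; _∷_)
open import Function using (_∘_; _on_)
open import Function.Bundles using (_⇔_; mk⇔; Equivalence)
open import Function.Definitions using (Injective; Surjective)
open import Induction.WellFounded using (Acc; acc)
open import Relation.Binary using (Rel; Decidable; IsEquivalence; IsDecEquivalence)
import Relation.Binary.Construct.On as On
open import Relation.Binary.PropositionalEquality using (_≡_; _≢_; refl; trans; cong; subst; subst₂; _≗_)
import Relation.Binary.PropositionalEquality as ≡
open import Relation.Nullary using (¬_; Dec; yes; no; ¬?)
import Relation.Nullary.Decidable as Dec
open import Relation.Nullary.Decidable using (_×-dec_; _→-dec_)

open Equivalence using (to; from)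

∣p∪q∣≤∣p∣+∣q∣ : ∀ {N} (p q : Subset N) → ∣ p ∪ q ∣ ≤ ∣ p ∣ + ∣ q ∣
∣p∪q∣≤∣p∣+∣q∣ [] [] = z≤n
∣p∪q∣≤∣p∣+∣q∣ (outside ∷ p) (outside ∷ q) = ∣p∪q∣≤∣p∣+∣q∣ p q
∣p∪q∣≤∣p∣+∣q∣ (outside ∷ p) (inside ∷ q) =
  ≤-trans (s≤s (∣p∪q∣≤∣p∣+∣q∣ p q)) (≤-reflexive (≡.sym (+-suc ∣ p ∣ ∣ q ∣)))
∣p∪q∣≤∣p∣+∣q∣ (inside ∷ p) (outside ∷ q) = s≤s (∣p∪q∣≤∣p∣+∣q∣ p q)
∣p∪q∣≤∣p∣+∣q∣ (inside ∷ p) (inside ∷ q) =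
  s≤s (≤-trans (∣p∪q∣≤∣p∣+∣q∣ p q) (+-monoʳ-≤ ∣ p ∣ (n≤1+n ∣ q ∣)))

∪-monoʳ-⊆ : ∀ {N} (p : Subset N) {q r} → q ⊆ r → p ∪ q ⊆ p ∪ r
∪-monoʳ-⊆ p {q} q⊆r = x∈p∪q⁺ ∘ map₂ q⊆r ∘ x∈p∪q⁻ p q

image : ∀ {m N} → (Fin m → Fin N) → Subset N
image {zero}  ψ = ⊥
image {suc m} ψ = ⁅ ψ zero ⁆ ∪ image (ψ ∘ suc)

∈-image : ∀ {m N} (ψ : Fin m → Fin N) a → ψ a ∈ image ψ
∈-image ψ zero    = p⊆p∪q _ (x∈⁅x⁆ (ψ zero))
∈-image ψ (suc a) = q⊆p∪q ⁅ ψ zero ⁆ _ (∈-image (ψ ∘ suc) a)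

∣image∣≤ : ∀ {m N} (ψ : Fin m → Fin N) → ∣ image ψ ∣ ≤ m
∣image∣≤ {zero}  {N} ψ = ≤-reflexive (∣⊥∣≡0 N)
∣image∣≤ {suc m} ψ = begin
  ∣ ⁅ ψ zero ⁆ ∪ image (ψ ∘ suc) ∣        ≤⟨ ∣p∪q∣≤∣p∣+∣q∣ ⁅ ψ zero ⁆ _ ⟩
  ∣ ⁅ ψ zero ⁆ ∣ + ∣ image (ψ ∘ suc) ∣     ≡⟨ cong (_+ ∣ image (ψ ∘ suc) ∣) (∣⁅x⁆∣≡1 (ψ zero)) ⟩
  suc ∣ image (ψ ∘ suc) ∣                 ≤⟨ s≤s (∣image∣≤ (ψ ∘ suc)) ⟩
  suc m                                   ∎
  where open ≤-Reasoning

minimalSubset : ∀ {N p} {P : Subset N → Set p} → (∀ S → Dec (P S)) → ∀ {S₀} → P S₀ →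
  Σ (Subset N) λ S → P S × ∣ S ∣ ≤ ∣ S₀ ∣ × (∀ S′ → P S′ → ∣ S ∣ ≤ ∣ S′ ∣)
minimalSubset {N} {P = P} P? {S₀} pS₀ = go S₀ (<-wellFounded ∣ S₀ ∣) pS₀
  where
  go : ∀ S → Acc _<_ ∣ S ∣ → P S →
    Σ (Subset N) λ S* → P S* × ∣ S* ∣ ≤ ∣ S ∣ × (∀ S′ → P S′ → ∣ S* ∣ ≤ ∣ S′ ∣)
  go S (acc smaller) pS with anySubset? (λ S′ → P? S′ ×-dec (∣ S′ ∣ <? ∣ S ∣))
  ... | no none = S , pS , ≤-refl , λ S′ pS′ → ≮⇒≥ λ ∣S′∣<∣S∣ → none (S′ , pS′ , ∣S′∣<∣S∣)
  ... | yes (S′ , pS′ , ∣S′∣<∣S∣) with go S′ (smaller ∣S′∣<∣S∣) pS′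
  ...   | S* , pS* , ∣S*∣≤∣S′∣ , least = S* , pS* , ≤-trans ∣S*∣≤∣S′∣ (<⇒≤ ∣S′∣<∣S∣) , least

any-fun? : ∀ {m N p} {P : (Fin m → Fin N) → Set p} →
  (∀ {f g} → f ≗ g → P f → P g) → (∀ f → Dec (P f)) → Dec (∃ P)
any-fun? resp P? = Dec.map′
  (λ (k , pk) → finToFun k , pk)
  (λ (f , pf) → funToFin f , resp (≡.sym ∘ finToFun-funToFin f) pf)
  (any? (P? ∘ finToFun))

lookup-injective : ∀ {a} {A : Set a} {xs : List A} → Unique xs → Injective _≡_ _≡_ (lookup xs)
lookup-injective (_ ∷ _)      {zero}  {zero}  _ = refl
lookup-injective (x∉xs ∷ _)   {zero}  {suc j} q = ⊥-elim (All.lookup x∉xs (∈-lookup j) q)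
lookup-injective (x∉xs ∷ _)   {suc i} {zero}  q = ⊥-elim (All.lookup x∉xs (∈-lookup i) (≡.sym q))
lookup-injective (_ ∷ unique) {suc i} {suc j} q = cong suc (lookup-injective unique q)

-- Numbering the classes of a decidable equivalence relation on Fin m

Classification : ∀ {m ℓ} → Rel (Fin m) ℓ → ℕ → Set ℓ
Classification {m} _≈_ r =
  Σ (Fin m → Fin r) λ f → Surjective _≡_ _≡_ f × (∀ u v → (f u ≡ f v) ⇔ (u ≈ v))

module _ {m ℓ} {_≈_ : Rel (Fin (suc m)) ℓ} (≈-isEquivalence : IsEquivalence _≈_) where

  open IsEquivalence ≈-isEquivalence using () renaming (refl to ≈-refl; sym to ≈-sym; trans to ≈-trans)

  classification-join : ∀ {r} v₀ → zero ≈ suc v₀ →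
    Classification (_≈_ on suc) r → Classification _≈_ r
  classification-join {r} v₀ 0≈v₀ (f , f-surjective , f-classes) =
    f′ , f′-surjective , λ u v → mk⇔ (sound u v) (complete u v)
    where
    f′ : Fin (suc m) → Fin r
    f′ zero    = f v₀
    f′ (suc v) = f v

    f′-surjective : Surjective _≡_ _≡_ f′
    f′-surjective i with f-surjective i
    ... | v , fv≡i = suc v , λ { refl → fv≡i refl }

    sound : ∀ u v → f′ u ≡ f′ v → u ≈ v
    sound zero    zero    _ = ≈-refl
    sound zero    (suc v) q = ≈-trans 0≈v₀ (to (f-classes v₀ v) q)
    sound (suc u) zero    q = ≈-trans (to (f-classes u v₀) q) (≈-sym 0≈v₀)
    sound (suc u) (suc v) q = to (f-classes u v) q

    complete : ∀ u v → u ≈ v → f′ u ≡ f′ v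
    complete zero    zero    _ = refl
    complete zero    (suc v) p = from (f-classes v₀ v) (≈-trans (≈-sym 0≈v₀) p)
    complete (suc u) zero    p = from (f-classes u v₀) (≈-trans p 0≈v₀)
    complete (suc u) (suc v) p = from (f-classes u v) p

  classification-fresh : ∀ {r} → (∀ v → ¬ zero ≈ suc v) →
    Classification (_≈_ on suc) r → Classification _≈_ (suc r)
  classification-fresh {r} 0≉ (f , f-surjective , f-classes) =
    f′ , f′-surjective , λ u v → mk⇔ (sound u v) (complete u v)
    where
    f′ : Fin (suc m) → Fin (suc r)
    f′ zero    = zero
    f′ (suc v) = suc (f v)

    f′-surjective : Surjective _≡_ _≡_ f′
    f′-surjective zero = zero , λ { refl → refl }
    f′-surjective (suc i) with f-surjective i
    ... | v , fv≡i = suc v , λ { refl → cong suc (fv≡i refl) }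

    sound : ∀ u v → f′ u ≡ f′ v → u ≈ v
    sound zero    zero    _ = ≈-refl
    sound (suc u) (suc v) q = to (f-classes u v) (suc-injective q)

    complete : ∀ u v → u ≈ v → f′ u ≡ f′ v
    complete zero    zero    _ = refl
    complete zero    (suc v) p = ⊥-elim (0≉ v p)
    complete (suc u) zero    p = ⊥-elim (0≉ u (≈-sym p))
    complete (suc u) (suc v) p = cong suc (from (f-classes u v) p)

classify : ∀ {m ℓ} {_≈_ : Rel (Fin m) ℓ} → IsDecEquivalence _≈_ → ∃ (Classification _≈_)
classify {zero} _ = 0 , (λ ()) , (λ ()) , (λ ())
classify {suc m} {_≈_ = _≈_} isDecEquivalence =
  extend (classify (On.isDecEquivalence suc isDecEquivalence)) (any? (λ v → zero ≟ suc v))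
  where
  open IsDecEquivalence isDecEquivalence using (isEquivalence; _≟_)

  extend : ∃ (Classification (_≈_ on suc)) → Dec (∃ λ v → zero ≈ suc v) → ∃ (Classification _≈_)
  extend (r , classes) (yes (v₀ , 0≈v₀)) = r , classification-join isEquivalence v₀ 0≈v₀ classes
  extend (r , classes) (no 0≉) = suc r , classification-fresh isEquivalence (λ v 0≈v → 0≉ (v , 0≈v)) classes

Adj? : (G : Graph) → Decidable (Adj G)
Adj? G u v = adj G u v ≟ᵇ true

Adj-sym : (G : Graph) {u v : Fin (n G)} → Adj G u v → Adj G v u
Adj-sym G {u} {v} u~v = trans (sym G v u) u~v

module _ {G : Graph} where

  Reachable-trans : ∀ {u v w} → Reachable G u v → Reachable G v w → Reachable G u w
  Reachable-trans here         v↝w = v↝w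
  Reachable-trans (step u~ ↝v) v↝w = step u~ (Reachable-trans ↝v v↝w)

  Reachable-sym : ∀ {u v} → Reachable G u v → Reachable G v u
  Reachable-sym here         = here
  Reachable-sym (step u~ ↝v) = Reachable-trans (Reachable-sym ↝v) (step (Adj-sym G u~) here)

-- Grow a set of vertices reachable from u by neighbours outside it, until it is closed under adjacency.
reachabilityClass : (G : Graph) (u : Fin (n G)) → Σ (Subset (n G)) λ A → ∀ v → v ∈ A ⇔ Reachable G u v
reachabilityClass G u = grow ⁅ u ⁆ (⊃-wellFounded _) (x∈⁅x⁆ u) (λ v∈ → subst (Reachable G u) (≡.sym (x∈⁅y⁆⇒x≡y u v∈)) here)
  where
  grow : ∀ A → Acc _⊃_ A → u ∈ A → (∀ {v} → v ∈ A → Reachable G u v) →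
    Σ (Subset (n G)) λ A → ∀ v → v ∈ A ⇔ Reachable G u v
  grow A (acc larger) u∈A sound with any? (λ x → any? λ w → x ∈? A ×-dec (Adj? G x w ×-dec ¬? (w ∈? A)))
  ... | yes (x , w , x∈A , x~w , w∉A) =
    grow (A ∪ ⁅ w ⁆) (larger (p⊆p∪q ⁅ w ⁆ , w , q⊆p∪q A ⁅ w ⁆ (x∈⁅x⁆ w) , w∉A)) (p⊆p∪q ⁅ w ⁆ u∈A) sound′
    where
    sound′ : ∀ {v} → v ∈ A ∪ ⁅ w ⁆ → Reachable G u v
    sound′ {v} v∈ with x∈p∪q⁻ A ⁅ w ⁆ v∈
    ... | inj₁ v∈A = sound v∈A
    ... | inj₂ v∈w = subst (Reachable G u) (≡.sym (x∈⁅y⁆⇒x≡y w v∈w)) (Reachable-trans (sound x∈A) (step x~w here))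
  ... | no closed = A , λ v → mk⇔ sound (complete u∈A)
    where
    complete : ∀ {x v} → x ∈ A → Reachable G x v → v ∈ A
    complete x∈A here = x∈A
    complete {x} x∈A (step {v = y} x~y y↝v) with y ∈? A
    ... | yes y∈A = complete y∈A y↝v
    ... | no  y∉A = ⊥-elim (closed (x , y , x∈A , x~y , y∉A))

Reachable? : (G : Graph) → Decidable (Reachable G)
Reachable? G u v = Dec.map (proj₂ (reachabilityClass G u) v) (v ∈? proj₁ (reachabilityClass G u))

Reachable-isDecEquivalence : (G : Graph) → IsDecEquivalence (Reachable G)
Reachable-isDecEquivalence G = record
  { isEquivalence = record { refl = here ; sym = Reachable-sym ; trans = Reachable-trans }
  ; _≟_           = Reachable? G
  }

numComponents : (F : Graph) → ∃ (NumComponents F)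
numComponents F = classify (Reachable-isDecEquivalence F)

module Component (F : Graph) {r : ℕ} (components : NumComponents F r) (i : Fin r) where

  class : Fin (n F) → Fin r
  class = proj₁ components

  private
    class≡⇔Reachable : ∀ u v → (class u ≡ class v) ⇔ Reachable F u v
    class≡⇔Reachable = proj₂ (proj₂ components)

  members : List (Fin (n F))
  members = filter (λ v → class v ≟ᶠ i) (allFin (n F))

  embed : Fin (length members) → Fin (n F)
  embed = lookup members

  graph : Graph
  graph = record
    { n      = length members
    ; adj    = λ a b → adj F (embed a) (embed b)
    ; sym    = λ a b → sym F (embed a) (embed b)
    ; irrefl = λ a → irrefl F (embed a)
    }

  embed-injective : Injective _≡_ _≡_ embed
  embed-injective = lookup-injective (filter⁺ _ (allFin⁺ (n F)))

  class-embed : ∀ a → class (embed a) ≡ i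
  class-embed a = proj₂ (∈-filter⁻ (λ v → class v ≟ᶠ i) {xs = allFin (n F)} (∈-lookup a))

  position : ∀ {v} → class v ≡ i → Fin (n graph)
  position {v} p = index (∈-filter⁺ (λ v → class v ≟ᶠ i) (∈-allFin v) p)

  embed-position : ∀ {v} (p : class v ≡ i) → embed (position p) ≡ v
  embed-position {v} p = ≡.sym (lookup-index (∈-filter⁺ (λ v → class v ≟ᶠ i) (∈-allFin v) p))

  class-Reachable : ∀ {u v} → class u ≡ i → Reachable F u v → class v ≡ i
  class-Reachable {u} {v} p u↝v = trans (≡.sym (from (class≡⇔Reachable u v) u↝v)) p

  Reachable-graph : ∀ {x y} → Reachable F x y → ∀ {a b} → embed a ≡ x → embed b ≡ y → Reachable graph a b
  Reachable-graph here {a} ea eb = subst (Reachable graph a) (embed-injective (trans ea (≡.sym eb))) here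
  Reachable-graph (step {v = x′} x~x′ x′↝y) {a} ea eb =
    step (subst₂ (Adj F) (≡.sym ea) (≡.sym (embed-position x′∈)) x~x′)
         (Reachable-graph x′↝y (embed-position x′∈) eb)
    where
    x′∈ : class x′ ≡ i
    x′∈ = class-Reachable (subst (λ x → class x ≡ i) ea (class-embed a)) (step x~x′ here)

  connected : Connected graph
  connected a b =
    Reachable-graph (to (class≡⇔Reachable _ _) (trans (class-embed a) (≡.sym (class-embed b)))) refl refl

  nonempty : 1 ≤ n graph
  nonempty with proj₁ (proj₂ components) i
  ... | v , class≡i = ≤-trans (s≤s z≤n) (toℕ<n (position (class≡i refl)))

  closed : ∀ a w → Adj F (embed a) w → ∃ λ b → embed b ≡ w
  closed a w a~w = position w∈ , embed-position w∈
    where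
    w∈ : class w ≡ i
    w∈ = class-Reachable (class-embed a) (step a~w here)

  isComponent : IsComponent graph F
  isComponent = embed , embed-injective , (λ _ _ → refl) , connected , nonempty , closed

EmbeddingAvoiding : (G : Graph) → Subset (n G) → (F : Graph) → (Fin (n F) → Fin (n G)) → Set
EmbeddingAvoiding G S F φ =
  Injective _≡_ _≡_ φ × (∀ v → φ v ∉ S) × (∀ u v → Adj F u v → Adj G (φ u) (φ v))

EmbeddingAvoiding-resp-≗ : ∀ G S F {φ ψ} → φ ≗ ψ → EmbeddingAvoiding G S F φ → EmbeddingAvoiding G S F ψ
EmbeddingAvoiding-resp-≗ G S F φ≗ψ (φ-injective , φ-avoids , φ-adj) =
  (λ {u} {v} q → φ-injective (trans (φ≗ψ u) (trans q (≡.sym (φ≗ψ v))))) ,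
  (λ v → subst (_∉ S) (φ≗ψ v) (φ-avoids v)) ,
  (λ u v u~v → subst₂ (Adj G) (φ≗ψ u) (φ≗ψ v) (φ-adj u v u~v))

embeddingAvoiding? : ∀ G S F φ → Dec (EmbeddingAvoiding G S F φ)
embeddingAvoiding? G S F φ =
  Dec.map′ (λ inj {u} {v} → inj u v) (λ inj u v → inj) (all? λ u → all? λ v → (φ u ≟ᶠ φ v) →-dec (u ≟ᶠ v))
  ×-dec all? (λ v → ¬? (φ v ∈? S))
  ×-dec all? (λ u → all? λ v → Adj? F u v →-dec Adj? G (φ u) (φ v))

containsAvoiding? : ∀ G S F → Dec (ContainsAvoiding G S F)
containsAvoiding? G S F = any-fun? (EmbeddingAvoiding-resp-≗ G S F) (embeddingAvoiding? G S F)

ContainsAvoiding-antitone : ∀ G F {S T} → S ⊆ T → ContainsAvoiding G T F → ContainsAvoiding G S F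
ContainsAvoiding-antitone G F S⊆T (φ , φ-injective , φ-avoids , φ-adj) =
  φ , φ-injective , (λ v → φ-avoids v ∘ S⊆T) , φ-adj

hits? : ∀ G Fs S → Dec (Hits G Fs S)
hits? G Fs S = Dec.map′
  (λ all F → All.lookup all)
  (λ hits → All.tabulate (hits _))
  (All.all? (λ F → ¬? (containsAvoiding? G S F)) Fs)

-- Copies of a family of graphs with pairwise disjoint vertex sets, as one embedding of their disjoint union.
DisjointCopiesAvoiding : (G : Graph) → Subset (n G) → ∀ {r} → (Fin r → Graph) → Set
DisjointCopiesAvoiding G T {r} K =
  Σ (Σ (Fin r) (λ i → Fin (n (K i))) → Fin (n G)) λ ψ →
    Injective _≡_ _≡_ ψ × (∀ x → ψ x ∉ T) ×
    (∀ i a b → Adj (K i) a b → Adj G (ψ (i , a)) (ψ (i , b)))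

greedyCopies : ∀ G T {r} (K : Fin r → Graph) {c} → (∀ i → n (K i) ≤ c) →
  (Σ (Fin r) λ i → Σ (Subset (n G)) λ X → ∣ X ∣ ≤ r * c × ¬ ContainsAvoiding G (T ∪ X) (K i))
  ⊎ DisjointCopiesAvoiding G T K
greedyCopies G T {zero} K _ = inj₂ ((λ ()) , (λ { {() , _} }) , (λ ()) , (λ ()))
greedyCopies G T {suc r} K K≤c with containsAvoiding? G T (K zero)
... | no ¬copy₀ =
  inj₁ (zero , ⊥ , ≤-trans (≤-reflexive (∣⊥∣≡0 (n G))) z≤n , ¬copy₀ ∘ ContainsAvoiding-antitone G (K zero) (p⊆p∪q ⊥))
... | yes (ψ₀ , ψ₀-injective , ψ₀-avoids , ψ₀-adj) with greedyCopies G (T ∪ image ψ₀) (K ∘ suc) (K≤c ∘ suc)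
...   | inj₁ (i , X , ∣X∣≤ , ¬copy) =
  inj₁ (suc i , image ψ₀ ∪ X ,
        ≤-trans (∣p∪q∣≤∣p∣+∣q∣ (image ψ₀) X) (+-mono-≤ (≤-trans (∣image∣≤ ψ₀) (K≤c zero)) ∣X∣≤) ,
        ¬copy ∘ ContainsAvoiding-antitone G (K (suc i)) (⊆-reflexive (∪-assoc T (image ψ₀) X)))
...   | inj₂ (ψ , ψ-injective , ψ-avoids , ψ-adj) = inj₂ (Ψ , Ψ-injective , Ψ-avoids , Ψ-adj)
  where
  Ψ : Σ (Fin (suc r)) (λ i → Fin (n (K i))) → Fin (n G)
  Ψ (zero  , a) = ψ₀ a
  Ψ (suc i , a) = ψ (i , a)

  ψ∉image : ∀ x a → ψ x ≢ ψ₀ a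
  ψ∉image x a q = ψ-avoids x (subst (_∈ T ∪ image ψ₀) (≡.sym q) (q⊆p∪q T _ (∈-image ψ₀ a)))

  Ψ-injective : Injective _≡_ _≡_ Ψ
  Ψ-injective {zero  , a} {zero  , b} q = cong (zero ,_) (ψ₀-injective q)
  Ψ-injective {zero  , a} {suc j , b} q = ⊥-elim (ψ∉image (j , b) a (≡.sym q))
  Ψ-injective {suc i , a} {zero  , b} q = ⊥-elim (ψ∉image (i , a) b q)
  Ψ-injective {suc i , a} {suc j , b} q = cong (λ { (k , c) → suc k , c }) (ψ-injective q)

  Ψ-avoids : ∀ x → Ψ x ∉ T
  Ψ-avoids (zero  , a) = ψ₀-avoids a
  Ψ-avoids (suc i , a) = ψ-avoids (i , a) ∘ p⊆p∪q _

  Ψ-adj : ∀ i a b → Adj (K i) a b → Adj G (Ψ (i , a)) (Ψ (i , b))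
  Ψ-adj zero    = ψ₀-adj
  Ψ-adj (suc i) = ψ-adj i

copies⇒contains : ∀ F {r} (components : NumComponents F r) G {T} →
  DisjointCopiesAvoiding G T (Component.graph F components) → ContainsAvoiding G T F
copies⇒contains F {r} components G (ψ , ψ-injective , ψ-avoids , ψ-adj) =
  ψ ∘ locate , locate-injective ∘ ψ-injective , (λ v → ψ-avoids (locate v)) , φ-adj
  where
  module C = Component F components

  class : Fin (n F) → Fin r
  class = proj₁ components

  locate : Fin (n F) → Σ _ λ i → Fin (n (C.graph i))
  locate v = class v , C.position (class v) refl

  locate-≡ : ∀ {i v} (p : class v ≡ i) → locate v ≡ (i , C.position i p)
  locate-≡ refl = refl

  locate-injective : Injective _≡_ _≡_ locate
  locate-injective {u} {v} q = begin
    u                                   ≡⟨ ≡.sym (C.embed-position _ refl) ⟩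
    C.embed (class u) (proj₂ (locate u)) ≡⟨ cong (λ (i , a) → C.embed i a) q ⟩
    C.embed (class v) (proj₂ (locate v)) ≡⟨ C.embed-position _ refl ⟩
    v                                   ∎
    where open ≡.≡-Reasoning

  φ-adj : ∀ u v → Adj F u v → Adj G (ψ (locate u)) (ψ (locate v))
  φ-adj u v u~v = subst (λ x → Adj G (ψ (locate u)) (ψ x)) (≡.sym (locate-≡ same))
    (ψ-adj (class u) _ _ (subst₂ (Adj F) (≡.sym (C.embed-position _ refl)) (≡.sym (C.embed-position _ same)) u~v))
    where
    same : class v ≡ class u
    same = C.class-Reachable (class u) refl (step u~v here)

ComponentBlocker : (G : Graph) → Subset (n G) → ℕ → Graph → Set
ComponentBlocker G S B F =
  Σ Graph λ K → IsComponent K F × Σ (Subset (n G)) λ X → ∣ X ∣ ≤ B × ¬ ContainsAvoiding G (S ∪ X) K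

componentBlocker : ∀ G S F {r} (components : NumComponents F r) {c B} →
  (∀ K → IsComponent K F → n K ≤ c) → r * c ≤ B → ¬ ContainsAvoiding G S F → ComponentBlocker G S B F
componentBlocker G S F components size≤ rc≤B ¬F
  with greedyCopies G S (Component.graph F components) (λ i → size≤ _ (Component.isComponent F components i))
... | inj₁ (i , X , ∣X∣≤ , ¬Kᵢ) =
  Component.graph F components i , Component.isComponent F components i , X , ≤-trans ∣X∣≤ rc≤B , ¬Kᵢ
... | inj₂ copies = ⊥-elim (¬F (copies⇒contains F components G copies))

blockAll : ∀ G S B (Fs : List Graph) → (∀ F → F ∈ˡ Fs → ComponentBlocker G S B F) →
  Σ (List Graph) λ Fs′ → InConn Fs′ Fs ×
    Σ (Subset (n G)) λ Y → ∣ Y ∣ ≤ length Fs * B × Hits G Fs′ (S ∪ Y)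
blockAll G S B [] _ = [] , [] , ⊥ , ≤-reflexive (∣⊥∣≡0 (n G)) , λ _ ()
blockAll G S B (F ∷ Fs) blockers with blockers F (here refl) | blockAll G S B Fs (λ F′ → blockers F′ ∘ there)
... | K , K-component , X , ∣X∣≤ , ¬K | Fs′ , conn , Y , ∣Y∣≤ , hits =
  K ∷ Fs′ , K-component ∷ conn , X ∪ Y , ≤-trans (∣p∪q∣≤∣p∣+∣q∣ X Y) (+-mono-≤ ∣X∣≤ ∣Y∣≤) , hits′
  where
  hits′ : Hits G (K ∷ Fs′) (S ∪ (X ∪ Y))
  hits′ _  (here refl)  = ¬K ∘ ContainsAvoiding-antitone G K (∪-monoʳ-⊆ S (p⊆p∪q Y))
  hits′ K′ (there K′∈) = hits K′ K′∈ ∘ ContainsAvoiding-antitone G K′ (∪-monoʳ-⊆ S (q⊆p∪q X Y))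

n≤n*n : ∀ n → n ≤ n * n
n≤n*n zero    = z≤n
n≤n*n (suc n) = m≤m*n (suc n) (suc n)

memberBlocker : ∀ {Fs ℓ c} G S →
  (∀ F → F ∈ˡ Fs → ∀ k → NumComponents F k → k ≤ ℓ) →
  (∀ F → F ∈ˡ Fs → ∀ K → IsComponent K F → n K ≤ c) →
  Hits G Fs S → ∀ F → F ∈ˡ Fs → ComponentBlocker G S (ℓ * (c * c)) F
memberBlocker {c = c} G S ℓ-max c-max S-hits F F∈ with numComponents F
... | r , components = componentBlocker G S F components (c-max F F∈)
  (*-mono-≤ (ℓ-max F F∈ r components) (n≤n*n c)) (S-hits F F∈)

lemma4p1 : (Fs : List Graph) (ℓ c : ℕ) →
    IsMaxNumComponents Fs ℓ → IsMaxComponentSize Fs c →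
    (G : Graph) (k : ℕ) → IsOpt G Fs k →
    Σ (List Graph) λ Fs' → InConn Fs' Fs ×
      Σ ℕ λ k' → IsOpt G Fs' k' × k' ≤ k + alpha Fs ℓ c
lemma4p1 Fs ℓ c (ℓ-max , _) (c-max , _) G k ((S , S-hits , ∣S∣≡k) , _)
  with blockAll G S (ℓ * (c * c)) Fs (memberBlocker G S ℓ-max c-max S-hits)
... | Fs′ , conn , Y , ∣Y∣≤ , SY-hits with minimalSubset (hits? G Fs′) SY-hits
... | S′ , S′-hits , ∣S′∣≤ , S′-minimal =
  Fs′ , conn , ∣ S′ ∣ , ((S′ , S′-hits , refl) , S′-minimal) , (begin
    ∣ S′ ∣                         ≤⟨ ∣S′∣≤ ⟩
    ∣ S ∪ Y ∣                      ≤⟨ ∣p∪q∣≤∣p∣+∣q∣ S Y ⟩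
    ∣ S ∣ + ∣ Y ∣                  ≤⟨ +-mono-≤ (≤-reflexive ∣S∣≡k) ∣Y∣≤ ⟩
    k + length Fs * (ℓ * (c * c))  ≡⟨ cong (k +_) (≡.sym (*-assoc (length Fs) ℓ (c * c))) ⟩
    k + alpha Fs ℓ c               ∎)
  where open ≤-Reasoning
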